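{- Let $p$ be a prime, $q=p^{n}$, and $F=\mathrm{GF}(q)=\{a_{0}=0,a_{1},\dots,a_{q-1}\}$. For $c\in F$ let $f_{c}:F\to F$, $f_{c}(x)=cx$, and let $M(f_{c})$ be the $q\times q$ matrix over $F$, with rows and columns indexed by the elements of $F$, whose $(a,b)$ entry is $f_{c}(b-a)$. Let $H_{q}$ be the $q^{2}\times q^{2}$ block matrix whose $(i,m)$ block ($0\le i,m\le q-1$) is $M(f_{a_{i}+a_{m}})$. Let $J$ be the $q^{2}\times q^{2}$ matrix all of whose entries equal $1\in F$. Let $H$ be the $q^{3}\times q^{3}$ block matrix $H=[K_{i,m}]_{0\le i,m\le q-1}$ with $(i,m)$ block $K_{i,m}=a_{i}a_{m}J+H_{q}$ (so the blocks in block-row $0$ and block-column $0$ are all $H_{q}$). Then $H$ is a $\mathrm{GH}(q,q^{2})$ over the additive group of $F$.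
   Context: For a finite additive abelian group $U$ of order $u$ and a positive integer $\lambda$, a generalized Hadamard matrix $\mathrm{GH}(u,\lambda)$ over $U$ is a square matrix $[d_{ij}]$ of order $u\lambda$ with entries in $U$ such that for any two distinct rows $i\neq \ell$, the multiset $\{d_{ij}-d_{\ell j}: 1\le j\le u\lambda\}$ contains each element of $U$ exactly $\lambda$ times. -}

module Defs where

open import Data.Nat as ℕ using (ℕ)
open import Data.Fin using (Fin; toℕ; remQuot; _≟_)
open import Data.List using (length; filter; allFin)
open import Data.Product using (Σ; _×_; _,_; proj₁; proj₂)
open import Relation.Binary.PropositionalEquality using (_≡_; _≢_)
open import Relation.Binary.Definitions using (DecidableEquality)
open import Relation.Nullary using (¬_)
open import Algebra.Structures using (IsCommutativeRing)
open import Function using (Bijective)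

-- A finite field with q elements, together with an enumeration
-- F = {a₀ = 0, a₁, …, a_{q-1}} given by a bijection a : Fin q → Carrier.
record FiniteField (q : ℕ) : Set₁ where
  field
    Carrier : Set
    _+_ _*_ : Carrier → Carrier → Carrier
    -_      : Carrier → Carrier
    0# 1#   : Carrier
    isCommutativeRing : IsCommutativeRing _≡_ _+_ _*_ -_ 0# 1#
    0≢1     : ¬ (0# ≡ 1#)
    inverse : ∀ x → ¬ (x ≡ 0#) → Σ Carrier (λ y → (x * y) ≡ 1#)
    _≟F_    : DecidableEquality Carrier
    a       : Fin q → Carrier
    a-bij   : Bijective _≡_ _≡_ a
    a₀≡0    : ∀ (i : Fin q) → toℕ i ≡ 0 → a i ≡ 0#

  infixl 7 _*_
  infixl 6 _+_ _-_
  _-_ : Carrier → Carrier → Carrier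
  x - y = x + (- y)

Mat : Set → ℕ → Set
Mat A n = Fin n → Fin n → A

-- Block matrix [B_{i,m}] with k × k blocks each of order n; row index
-- r ↦ (block-row i, inner row) via the standard r = i·n + inner.
block : {A : Set} {k n : ℕ} → (Fin k → Fin k → Mat A n) → Mat A (k ℕ.* n)
block {k = k} {n} B r s with remQuot {k} n r | remQuot {k} n s
... | (i , r′) | (m , s′) = B i m r′ s′

module _ {u : ℕ} (F : FiniteField u) where
  open FiniteField F

  count : {N : ℕ} → (Fin N → Carrier) → Carrier → ℕ
  count {N} f x = length (filter (λ j → f j ≟F x) (allFin N))

  IsGH : (λ′ : ℕ) → Mat Carrier (u ℕ.* λ′) → Set
  IsGH λ′ d = ∀ (i ℓ : Fin (u ℕ.* λ′)) → ¬ (i ≡ ℓ) → ∀ (x : Carrier) →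
              count (λ j → d i j - d ℓ j) x ≡ λ′

module Construction {q : ℕ} (F : FiniteField q) where
  open FiniteField F

  f : Carrier → Carrier → Carrier
  f c x = c * x

  M : (Carrier → Carrier) → Mat Carrier q
  M g r s = g (a s - a r)

  Hq : Mat Carrier (q ℕ.* q)
  Hq = block (λ i m → M (f (a i + a m)))

  J : Mat Carrier (q ℕ.* q)
  J _ _ = 1#

  K : Fin q → Fin q → Mat Carrier (q ℕ.* q)
  K i m r s = (a i * a m) * J r s + Hq r s

  H : Mat Carrier (q ℕ.* (q ℕ.* q))
  H = block K

module Submission where

-- Index a row of H by (i, j, x) ∈ (Fin q)³ (block row of H, block row of
-- H_q, row of M) and a column likewise by (m, k, y). The entry is
--   a_i a_m + (a_j + a_k)(a_y - a_x),
-- so the difference of rows (i,j,x) and (i′,j′,x′) at column (m,k,y) is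
--   (a_j - a_j′) a_y + (a_x′ - a_x) a_k + (a_i - a_i′) a_m + (a_j′ a_x′ - a_j a_x),
-- the quadratic terms a_k a_y cancelling: an affine form in (a_m, a_k, a_y).
-- For distinct rows some coefficient is nonzero, and a nonconstant affine
-- form on Fⁿ⁺¹ takes every value exactly qⁿ times (one variable is solved
-- for, the others are free). With n = 2 this gives q² occurrences of each x.

open import Defs
open import Data.Nat using (ℕ)

module FinSum where
  open import Data.Nat using (ℕ; zero; suc; _+_; _*_)
  open import Data.Nat.Properties using (+-*-semiring; +-assoc; +-identityʳ)
  open import Data.Fin using (Fin; zero; suc; combine; punchIn; _↑ˡ_; _↑ʳ_)
  open import Data.Fin.Properties using (punchInᵢ≢i)
  open import Function using (_∘_)
  open import Relation.Binary.PropositionalEquality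
  open import Algebra.Properties.Semiring.Sum +-*-semiring
    using (sum-remove; sum-replicate-zero)
  open import Algebra.Properties.Semiring.Sum +-*-semiring public
    using (sum; sum-syntax; sum-cong-≗; *-distribˡ-sum)
  open ≡-Reasoning

  sum-const : ∀ n c → ∑[ i < n ] c ≡ n * c
  sum-const zero    c = refl
  sum-const (suc n) c = cong (c +_) (sum-const n c)

  sum-single : ∀ {n} (g : Fin n → ℕ) (y₀ : Fin n) →
               (∀ y → y ≢ y₀ → g y ≡ 0) → sum g ≡ g y₀
  sum-single {suc n} g y₀ vanish = begin
    sum g                                ≡⟨ sum-remove {i = y₀} g ⟩
    g y₀ + ∑[ j < n ] g (punchIn y₀ j)   ≡⟨ cong (g y₀ +_) rest≡0 ⟩
    g y₀ + 0                             ≡⟨ +-identityʳ (g y₀) ⟩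
    g y₀                                 ∎
    where
    rest≡0 : ∑[ j < n ] g (punchIn y₀ j) ≡ 0
    rest≡0 = trans (sum-cong-≗ (λ j → vanish _ (punchInᵢ≢i y₀ j))) (sum-replicate-zero n)

  sum-++ : ∀ m n (g : Fin (m + n) → ℕ) →
           sum g ≡ ∑[ i < m ] g (i ↑ˡ n) + ∑[ j < n ] g (m ↑ʳ j)
  sum-++ zero    n g = refl
  sum-++ (suc m) n g = trans (cong (g zero +_) (sum-++ m n (g ∘ suc)))
                             (sym (+-assoc (g zero) _ _))

  sum-combine : ∀ m n (g : Fin (m * n) → ℕ) →
                sum g ≡ ∑[ i < m ] ∑[ t < n ] g (combine i t)
  sum-combine zero    n g = refl
  sum-combine (suc m) n g = trans (sum-++ n (m * n) g)
    (cong (∑[ t < n ] g (t ↑ˡ (m * n)) +_) (sum-combine m n (g ∘ (n ↑ʳ_))))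

module FieldAlgebra {q : ℕ} (F : FiniteField q) where
  open FiniteField F
  open import Data.Product using (proj₁; proj₂)
  open import Relation.Binary.PropositionalEquality
  open import Algebra.Bundles using (CommutativeRing)
  import Algebra.Properties.Ring as RingProperties
  import Algebra.Properties.Group as GroupProperties
  import Algebra.Properties.AbelianGroup as AbelianGroupProperties
  import Algebra.Properties.CommutativeSemigroup as CommutativeSemigroupProperties
  open ≡-Reasoning

  commutativeRing : CommutativeRing _ _
  commutativeRing = record { isCommutativeRing = isCommutativeRing }

  open CommutativeRing commutativeRing public using (zeroˡ; +-identityˡ)
  open CommutativeRing commutativeRing
    using (*-identityˡ; *-identityʳ; *-assoc; *-comm; +-identityʳ; -‿inverseʳ; +-comm; distribʳ;
           +-group; +-abelianGroup; +-commutativeSemigroup; ring)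
  open RingProperties ring using (x[y-z]≈xy-xz; [y-z]x≈yx-zx; -‿distribˡ-*)
  open GroupProperties +-group public using (x∙y⁻¹≈ε⇒x≈y)
  open GroupProperties +-group using (//-rightDividesˡ; //-rightDividesʳ)
  open AbelianGroupProperties +-abelianGroup using (⁻¹-∙-comm; ⁻¹-anti-homo‿-)
  open CommutativeSemigroupProperties +-commutativeSemigroup using (interchange; x∙yz≈y∙xz)

  neg-+ : ∀ u v → - (u + v) ≡ - u + - v
  neg-+ u v = sym (⁻¹-∙-comm u v)

  sub-interchange : ∀ u v u′ v′ → (u + v) - (u′ + v′) ≡ (u - u′) + (v - v′)
  sub-interchange u v u′ v′ = begin
    (u + v) + - (u′ + v′)    ≡⟨ cong ((u + v) +_) (neg-+ u′ v′) ⟩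
    (u + v) + (- u′ + - v′)  ≡⟨ interchange u v (- u′) (- v′) ⟩
    (u - u′) + (v - v′)      ∎

  sub-sub-interchange : ∀ u v u′ v′ → (u - v) - (u′ - v′) ≡ (u - u′) - (v - v′)
  sub-sub-interchange u v u′ v′ = begin
    (u + - v) - (u′ + - v′)      ≡⟨ sub-interchange u (- v) u′ (- v′) ⟩
    (u - u′) + (- v + - (- v′))  ≡⟨ cong ((u - u′) +_) (⁻¹-∙-comm v (- v′)) ⟩
    (u - u′) - (v - v′)          ∎

  sub-cancelʳ : ∀ u v w → (u + w) - (v + w) ≡ u - v
  sub-cancelʳ u v w = begin
    (u + w) - (v + w)    ≡⟨ sub-interchange u w v w ⟩
    (u - v) + (w - w)    ≡⟨ cong ((u - v) +_) (-‿inverseʳ w) ⟩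
    (u - v) + 0#         ≡⟨ +-identityʳ (u - v) ⟩
    u - v                ∎

  -- The part of two entries of H_q that depends on the rows j, x and j′, x′,
  -- as an affine form in a(y) and a(k); the cross term a(k)·a(y) cancels.
  product-difference : ∀ aj aj′ ax ax′ ak ay →
    (aj + ak) * (ay - ax) - (aj′ + ak) * (ay - ax′)
    ≡ (aj - aj′) * ay + ((ax′ - ax) * ak + (aj′ * ax′ - aj * ax))
  product-difference aj aj′ ax ax′ ak ay = begin
    (aj + ak) * (ay - ax) - (aj′ + ak) * (ay - ax′)
      ≡⟨ cong₂ _-_ (x[y-z]≈xy-xz (aj + ak) ay ax) (x[y-z]≈xy-xz (aj′ + ak) ay ax′) ⟩
    ((aj + ak) * ay - (aj + ak) * ax) - ((aj′ + ak) * ay - (aj′ + ak) * ax′)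
      ≡⟨ sub-sub-interchange _ _ _ _ ⟩
    ((aj + ak) * ay - (aj′ + ak) * ay) - ((aj + ak) * ax - (aj′ + ak) * ax′)
      ≡⟨ cong₂ _-_ y-part x-part ⟩
    (aj - aj′) * ay - ((ax - ax′) * ak + (aj * ax - aj′ * ax′))
      ≡⟨ cong ((aj - aj′) * ay +_) (neg-+ _ _) ⟩
    (aj - aj′) * ay + (- ((ax - ax′) * ak) + - (aj * ax - aj′ * ax′))
      ≡⟨ cong ((aj - aj′) * ay +_) (cong₂ _+_ negated-slope (⁻¹-anti-homo‿- _ _)) ⟩
    (aj - aj′) * ay + ((ax′ - ax) * ak + (aj′ * ax′ - aj * ax)) ∎
    where
    y-part : (aj + ak) * ay - (aj′ + ak) * ay ≡ (aj - aj′) * ay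
    y-part = trans (sym ([y-z]x≈yx-zx ay (aj + ak) (aj′ + ak))) (cong (_* ay) (sub-cancelʳ aj aj′ ak))
    x-part : (aj + ak) * ax - (aj′ + ak) * ax′ ≡ (ax - ax′) * ak + (aj * ax - aj′ * ax′)
    x-part = begin
      (aj + ak) * ax - (aj′ + ak) * ax′        ≡⟨ cong₂ _-_ (distribʳ ax aj ak) (distribʳ ax′ aj′ ak) ⟩
      (aj * ax + ak * ax) - (aj′ * ax′ + ak * ax′) ≡⟨ sub-interchange _ _ _ _ ⟩
      (aj * ax - aj′ * ax′) + (ak * ax - ak * ax′) ≡⟨ +-comm _ _ ⟩
      (ak * ax - ak * ax′) + (aj * ax - aj′ * ax′) ≡⟨ cong (_+ (aj * ax - aj′ * ax′)) k-slope ⟩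
      (ax - ax′) * ak + (aj * ax - aj′ * ax′)    ∎
      where
      k-slope : ak * ax - ak * ax′ ≡ (ax - ax′) * ak
      k-slope = trans (sym (x[y-z]≈xy-xz ak ax ax′)) (*-comm ak (ax - ax′))
    negated-slope : - ((ax - ax′) * ak) ≡ (ax′ - ax) * ak
    negated-slope = trans (-‿distribˡ-* (ax - ax′) ak) (cong (_* ak) (⁻¹-anti-homo‿- ax ax′))

  entry-difference : ∀ ai ai′ aj aj′ ax ax′ am ak ay →
    (ai * am * 1# + (aj + ak) * (ay - ax)) - (ai′ * am * 1# + (aj′ + ak) * (ay - ax′))
    ≡ (aj - aj′) * ay + ((ax′ - ax) * ak + ((ai - ai′) * am + (aj′ * ax′ - aj * ax)))
  entry-difference ai ai′ aj aj′ ax ax′ am ak ay = begin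
    (ai * am * 1# + (aj + ak) * (ay - ax)) - (ai′ * am * 1# + (aj′ + ak) * (ay - ax′))
      ≡⟨ sub-interchange _ _ _ _ ⟩
    (ai * am * 1# - ai′ * am * 1#) + ((aj + ak) * (ay - ax) - (aj′ + ak) * (ay - ax′))
      ≡⟨ cong₂ _+_ m-part (product-difference aj aj′ ax ax′ ak ay) ⟩
    (ai - ai′) * am + ((aj - aj′) * ay + ((ax′ - ax) * ak + γ))
      ≡⟨ x∙yz≈y∙xz _ _ _ ⟩
    (aj - aj′) * ay + ((ai - ai′) * am + ((ax′ - ax) * ak + γ))
      ≡⟨ cong ((aj - aj′) * ay +_) (x∙yz≈y∙xz _ _ _) ⟩
    (aj - aj′) * ay + ((ax′ - ax) * ak + ((ai - ai′) * am + γ)) ∎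
    where
    γ : Carrier
    γ = aj′ * ax′ - aj * ax
    m-part : ai * am * 1# - ai′ * am * 1# ≡ (ai - ai′) * am
    m-part = trans (cong₂ _-_ (*-identityʳ _) (*-identityʳ _)) (sym ([y-z]x≈yx-zx am ai ai′))

  inverse-cancel : ∀ {e c} → e * c ≡ 1# → ∀ z → e * (c * z) ≡ z
  inverse-cancel {e} {c} ec≡1 z = begin
    e * (c * z)   ≡⟨ sym (*-assoc e c z) ⟩
    (e * c) * z   ≡⟨ cong (_* z) ec≡1 ⟩
    1# * z        ≡⟨ *-identityˡ z ⟩
    z             ∎

  module AffineEquation {c : Carrier} (c≢0 : c ≢ 0#) (b x : Carrier) where
    c⁻¹ : Carrier
    c⁻¹ = proj₁ (inverse c c≢0)

    root : Carrier
    root = c⁻¹ * (x - b)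

    root-solves : c * root + b ≡ x
    root-solves = begin
      c * (c⁻¹ * (x - b)) + b   ≡⟨ cong (_+ b) (inverse-cancel (proj₂ (inverse c c≢0)) (x - b)) ⟩
      (x - b) + b               ≡⟨ //-rightDividesˡ b x ⟩
      x                         ∎

    root-unique : ∀ u → c * u + b ≡ x → u ≡ root
    root-unique u solves = begin
      u                          ≡⟨ sym (inverse-cancel c⁻¹c≡1 u) ⟩
      c⁻¹ * (c * u)              ≡⟨ cong (c⁻¹ *_) (sym (//-rightDividesʳ b (c * u))) ⟩
      c⁻¹ * ((c * u + b) - b)    ≡⟨ cong (λ v → c⁻¹ * (v - b)) solves ⟩
      c⁻¹ * (x - b)              ∎
      where
      c⁻¹c≡1 : c⁻¹ * c ≡ 1#
      c⁻¹c≡1 = trans (*-comm c⁻¹ c) (proj₂ (inverse c c≢0))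

module AffineCounting {q : ℕ} (F : FiniteField q) where
  open FiniteField F
  open FieldAlgebra F using (module AffineEquation; zeroˡ; +-identityˡ)
  open FinSum
  import Data.Nat as ℕ
  open import Data.Nat.Properties using (*-assoc; *-identityˡ; *-identityʳ)
  open import Data.Bool using (if_then_else_; true; false)
  open import Data.Fin using (Fin; zero; suc)
  open import Data.Fin.Properties using (all?; ¬∀⟶∃¬)
  open import Data.List using (length; filter; tabulate)
  open import Data.Product using (∃; _,_; proj₁; proj₂)
  open import Data.Vec.Functional using (Vector; head; tail)
  open import Function using (_∘_)
  open import Relation.Nullary using (yes; no; does; contradiction)
  open import Relation.Nullary.Decidable using (dec-true; dec-false)
  open import Relation.Binary.PropositionalEquality
  open ≡-Reasoning

  indicator : Carrier → Carrier → ℕ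
  indicator x u = if does (u ≟F x) then 1 else 0

  indicator-hit : ∀ {x u} → u ≡ x → indicator x u ≡ 1
  indicator-hit {x} {u} u≡x rewrite dec-true (u ≟F x) u≡x = refl

  indicator-miss : ∀ {x u} → u ≢ x → indicator x u ≡ 0
  indicator-miss {x} {u} u≢x rewrite dec-false (u ≟F x) u≢x = refl

  count-tabulate : ∀ {N M} (h : Fin N → Fin M) (g : Fin M → Carrier) x →
    length (filter (λ j → g j ≟F x) (tabulate h)) ≡ ∑[ i < N ] indicator x (g (h i))
  count-tabulate {ℕ.zero}  h g x = refl
  count-tabulate {ℕ.suc N} h g x with does (g (h zero) ≟F x)
  ... | true  = cong ℕ.suc (count-tabulate (h ∘ suc) g x)
  ... | false = count-tabulate (h ∘ suc) g x

  count-as-sum : ∀ {N} (g : Fin N → Carrier) x → count F g x ≡ ∑[ j < N ] indicator x (g j)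
  count-as-sum g x = count-tabulate (λ j → j) g x

  affine-count : ∀ {c} → c ≢ 0# → ∀ b x → ∑[ y < q ] indicator x (c * a y + b) ≡ 1
  affine-count {c} c≢0 b x =
    trans (sum-single _ y₀ (λ y y≢y₀ → indicator-miss (y≢y₀ ∘ a-injective ∘ hit-is-root y)))
          (indicator-hit (subst (λ u → c * u + b ≡ x) (sym a-y₀≡root) root-solves))
    where
    open AffineEquation c≢0 b x
    a-injective : ∀ {y y′} → a y ≡ a y′ → y ≡ y′
    a-injective = proj₁ a-bij
    y₀ : Fin q
    y₀ = proj₁ (proj₂ a-bij root)
    a-y₀≡root : a y₀ ≡ root
    a-y₀≡root = proj₂ (proj₂ a-bij root) refl
    hit-is-root : ∀ y → c * a y + b ≡ x → a y ≡ a y₀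
    hit-is-root y hit = trans (root-unique (a y) hit) (sym a-y₀≡root)

  leading≢0 : ∀ {n} {c : Vector Carrier (ℕ.suc n)} → ∃ (λ i → c i ≢ 0#) → (∀ i → tail c i ≡ 0#) → head c ≢ 0#
  leading≢0 (zero  , c₀≢0) tail≡0 = c₀≢0
  leading≢0 (suc i , cᵢ≢0) tail≡0 = contradiction (tail≡0 i) cᵢ≢0

  module _ (x : Carrier) where
    -- solutions n c b: the number of (m₁, …, mₙ) ∈ (Fin q)ⁿ with
    --   c₁·a(m₁) + … + cₙ·a(mₙ) + b = x,
    -- as a nested sum whose outermost index is m₁.
    solutions : (n : ℕ) → Vector Carrier n → Carrier → ℕ
    solutions ℕ.zero    c b = indicator x b
    solutions (ℕ.suc n) c b = ∑[ m < q ] solutions n (tail c) (head c * a m + b)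

    solutions-constant : ∀ n c b → (∀ i → c i ≡ 0#) → solutions n c b ≡ q ℕ.^ n ℕ.* indicator x b
    solutions-constant ℕ.zero    c b c≡0 = sym (*-identityˡ (indicator x b))
    solutions-constant (ℕ.suc n) c b c≡0 = begin
      ∑[ m < q ] solutions n (tail c) (head c * a m + b)
        ≡⟨ sum-cong-≗ {q} (λ m → solutions-constant n (tail c) _ (c≡0 ∘ suc)) ⟩
      ∑[ m < q ] (q ℕ.^ n ℕ.* indicator x (head c * a m + b))
        ≡⟨ sum-cong-≗ {q} (λ m → cong (λ u → q ℕ.^ n ℕ.* indicator x u) (vanishing m)) ⟩
      ∑[ m < q ] (q ℕ.^ n ℕ.* indicator x b)
        ≡⟨ sum-const q _ ⟩
      q ℕ.* (q ℕ.^ n ℕ.* indicator x b)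
        ≡⟨ sym (*-assoc q (q ℕ.^ n) _) ⟩
      q ℕ.^ ℕ.suc n ℕ.* indicator x b ∎
      where
      vanishing : ∀ m → head c * a m + b ≡ b
      vanishing m = trans (cong (λ c₀ → c₀ * a m + b) (c≡0 zero))
                          (trans (cong (_+ b) (zeroˡ (a m))) (+-identityˡ b))

    -- Only the first coefficient nonzero: the first variable is determined,
    -- the remaining n are free.
    solutions-leading : ∀ n c b → head c ≢ 0# → (∀ i → tail c i ≡ 0#) → solutions (ℕ.suc n) c b ≡ q ℕ.^ n
    solutions-leading n c b c₀≢0 tail≡0 = begin
      ∑[ m < q ] solutions n (tail c) (head c * a m + b)
        ≡⟨ sum-cong-≗ {q} (λ m → solutions-constant n (tail c) _ tail≡0) ⟩
      ∑[ m < q ] (q ℕ.^ n ℕ.* indicator x (head c * a m + b))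
        ≡⟨ sym (*-distribˡ-sum (q ℕ.^ n) (λ m → indicator x (head c * a m + b))) ⟩
      q ℕ.^ n ℕ.* ∑[ m < q ] indicator x (head c * a m + b)
        ≡⟨ cong (q ℕ.^ n ℕ.*_) (affine-count c₀≢0 b x) ⟩
      q ℕ.^ n ℕ.* 1
        ≡⟨ *-identityʳ (q ℕ.^ n) ⟩
      q ℕ.^ n ∎

    solutions-nonconstant : ∀ n c b → ∃ (λ i → c i ≢ 0#) → solutions (ℕ.suc n) c b ≡ q ℕ.^ n
    solutions-nonconstant n c b c≢0 with all? (λ i → tail c i ≟F 0#)
    ... | yes tail≡0 = solutions-leading n c b (leading≢0 c≢0 tail≡0) tail≡0
    solutions-nonconstant ℕ.zero c b c≢0 | no tail≢0 = contradiction (λ ()) tail≢0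
    solutions-nonconstant (ℕ.suc n) c b c≢0 | no tail≢0 = begin
      ∑[ m < q ] solutions (ℕ.suc n) (tail c) (head c * a m + b)
        ≡⟨ sum-cong-≗ {q} (λ m → solutions-nonconstant n (tail c) _ tail-witness) ⟩
      ∑[ m < q ] (q ℕ.^ n)
        ≡⟨ sum-const q (q ℕ.^ n) ⟩
      q ℕ.^ ℕ.suc n ∎
      where
      tail-witness : ∃ (λ i → tail c i ≢ 0#)
      tail-witness = ¬∀⟶∃¬ _ _ (λ i → tail c i ≟F 0#) tail≢0

module BlockEntry where
  open import Data.Nat using (ℕ; _*_)
  open import Data.Fin using (Fin; combine; remQuot)
  open import Data.Fin.Properties using (remQuot-combine)
  open import Data.Product using (proj₁; proj₂)
  open import Relation.Binary.PropositionalEquality using (_≡_; cong)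

  block-entry : {A : Set} {k n : ℕ} (B : Fin k → Fin k → Mat A n) (r : Fin (k * n)) (m : Fin k) (t : Fin n) →
    block B r (combine m t) ≡ B (proj₁ (remQuot {k} n r)) m (proj₂ (remQuot {k} n r)) t
  block-entry {k = k} {n} B r m t =
    cong (λ mt → B (proj₁ (remQuot {k} n r)) (proj₁ mt) (proj₂ (remQuot {k} n r)) (proj₂ mt))
         (remQuot-combine {k} {n} m t)

module Rows {q : ℕ} (F : FiniteField q) where
  open FiniteField F
  open Construction F
  open FieldAlgebra F using (entry-difference; x∙y⁻¹≈ε⇒x≈y)
  open AffineCounting F using (indicator; count-as-sum; solutions)
  open BlockEntry
  open FinSum
  import Data.Nat as ℕ
  open import Data.Fin using (Fin; zero; suc; combine; remQuot)
  open import Data.Fin.Properties using (combine-remQuot; ¬∀⟶∃¬)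
  open import Data.Product using (∃; proj₁; proj₂)
  open import Data.Vec.Functional using (Vector; []; _∷_)
  open import Relation.Binary.PropositionalEquality
  open ≡-Reasoning

  -- Row r of H has coordinates (outer r, middle r, inner r) ∈ (Fin q)³:
  -- the block row i of H, the block row j of H_q and the row x of M.
  -- rest r is the row (j, x) of H_q inside the block row outer r.
  rest : Fin (q ℕ.* (q ℕ.* q)) → Fin (q ℕ.* q)
  rest r = proj₂ (remQuot {q} (q ℕ.* q) r)

  outer middle inner : Fin (q ℕ.* (q ℕ.* q)) → Fin q
  outer  r = proj₁ (remQuot {q} (q ℕ.* q) r)
  middle r = proj₁ (remQuot {q} q (rest r))
  inner  r = proj₂ (remQuot {q} q (rest r))

  decompose : ∀ r → combine (outer r) (combine (middle r) (inner r)) ≡ r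
  decompose r = trans (cong (combine (outer r)) (combine-remQuot {q} q (rest r)))
                      (combine-remQuot {q} (q ℕ.* q) r)

  coordinates-determine : ∀ {r r′} → outer r ≡ outer r′ → middle r ≡ middle r′ → inner r ≡ inner r′ → r ≡ r′
  coordinates-determine {r} {r′} i≡ j≡ x≡ = begin
    r                                                      ≡⟨ sym (decompose r) ⟩
    combine (outer r) (combine (middle r) (inner r))       ≡⟨ cong₂ combine i≡ (cong₂ combine j≡ x≡) ⟩
    combine (outer r′) (combine (middle r′) (inner r′))    ≡⟨ decompose r′ ⟩
    r′                                                     ∎

  H-entry : ∀ r m k y → H r (combine m (combine k y))
    ≡ a (outer r) * a m * 1# + (a (middle r) + a k) * (a y - a (inner r))
  H-entry r m k y = trans (block-entry K r m (combine k y))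
    (cong (a (outer r) * a m * 1# +_) (block-entry (λ j k → M (f (a j + a k))) (rest r) k y))

  -- Coefficients of a(m), a(k), a(y) and the constant term of the
  -- difference of rows r and r′ (see entry-difference).
  coefficients : (r r′ : Fin (q ℕ.* (q ℕ.* q))) → Vector Carrier 3
  coefficients r r′ = (a (outer r) - a (outer r′)) ∷ (a (inner r′) - a (inner r)) ∷ (a (middle r) - a (middle r′)) ∷ []

  offset : (r r′ : Fin (q ℕ.* (q ℕ.* q))) → Carrier
  offset r r′ = a (middle r′) * a (inner r′) - a (middle r) * a (inner r)

  -- Distinct rows differ in some coordinate, so their difference is a
  -- nonconstant affine form.
  distinct-rows-nonconstant : ∀ {r r′} → r ≢ r′ → ∃ (λ t → coefficients r r′ t ≢ 0#)
  distinct-rows-nonconstant {r} {r′} r≢r′ =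
    ¬∀⟶∃¬ 3 _ (λ t → coefficients r r′ t ≟F 0#) λ all≡0 →
      r≢r′ (coordinates-determine (same (all≡0 zero)) (same (all≡0 (suc (suc zero))))
                                  (sym (same (all≡0 (suc zero)))))
    where
    same : ∀ {u v} → a u - a v ≡ 0# → u ≡ v
    same d≡0 = proj₁ a-bij (x∙y⁻¹≈ε⇒x≈y _ _ d≡0)

  count-as-solutions : ∀ r r′ x →
    count F (λ s → H r s - H r′ s) x ≡ solutions x 3 (coefficients r r′) (offset r r′)
  count-as-solutions r r′ x = begin
    count F D x                                                     ≡⟨ count-as-sum D x ⟩
    ∑[ s < q ℕ.* (q ℕ.* q) ] indicator x (D s)                       ≡⟨ sum-combine q (q ℕ.* q) _ ⟩
    ∑[ m < q ] ∑[ t < q ℕ.* q ] indicator x (D (combine m t))        ≡⟨ sum-cong-≗ {q} (λ m → sum-combine q q _) ⟩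
    ∑[ m < q ] ∑[ k < q ] ∑[ y < q ] indicator x (D (combine m (combine k y)))
      ≡⟨ sum-cong-≗ {q} (λ m → sum-cong-≗ {q} (λ k → sum-cong-≗ {q} (λ y → cong (indicator x) (affine m k y)))) ⟩
    solutions x 3 (coefficients r r′) (offset r r′)                  ∎
    where
    D : Fin (q ℕ.* (q ℕ.* q)) → Carrier
    D s = H r s - H r′ s
    affine : ∀ m k y → D (combine m (combine k y))
      ≡ (a (middle r) - a (middle r′)) * a y
        + ((a (inner r′) - a (inner r)) * a k + ((a (outer r) - a (outer r′)) * a m + offset r r′))
    affine m k y = trans (cong₂ _-_ (H-entry r m k y) (H-entry r′ m k y))
      (entry-difference (a (outer r)) (a (outer r′)) (a (middle r)) (a (middle r′))
                        (a (inner r)) (a (inner r′)) (a m) (a k) (a y))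

open import Data.Nat using (ℕ; _^_; _*_)
open import Data.Nat.Primality using (Prime)
open import Data.Nat.Properties using (*-identityʳ)
open import Relation.Binary.PropositionalEquality using (_≡_; cong; module ≡-Reasoning)
open ≡-Reasoning

theorem3p3 : (p n q : ℕ) → Prime p → q ≡ p ^ n → (F : FiniteField q) →
    IsGH F (q * q) (Construction.H F)
theorem3p3 p n q _ _ F r r′ r≢r′ x = begin
  count F (λ s → H r s - H r′ s) x                 ≡⟨ count-as-solutions r r′ x ⟩
  solutions x 3 (coefficients r r′) (offset r r′)  ≡⟨ solutions-nonconstant x 2 _ _ (distinct-rows-nonconstant r≢r′) ⟩
  q ^ 2                                            ≡⟨ cong (q *_) (*-identityʳ q) ⟩
  q * q                                            ∎
  where
  open FiniteField F using (_-_)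
  open Construction F using (H)
  open AffineCounting F using (solutions; solutions-nonconstant)
  open Rows F using (count-as-solutions; coefficients; offset; distinct-rows-nonconstant)
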